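{- Let $\mathscr{D}$ be a finite TBA generated as a Boolean algebra by its closed elements, and write $X=1_{\mathscr{D}}$. Then the set of atoms of $\mathscr{D}$ is a complete $P$-partition $\{X_{p}\mid p\in P\}$ of $X$ for some finite PO system $P$ (i.e. the atoms can be labelled so that $X_{p}^{\prime}=\bigcup_{q<p}X_{q}$ for all $p\in P$). The map $\gamma\colon Q\mapsto\bigcup_{q\in Q}X_{q}$ is an isomorphism from the TBA $(2^{P},^{\prime})$ onto $\mathscr{D}$, under which lower subsets of $P$ correspond to closed elements of $\mathscr{D}$. Moreover, if $Q_{1},\ldots,Q_{n}$ are lower subsets of $P$, then $\langle Q_{1},\ldots,Q_{n},^{\prime}\rangle=2^{P}$ if and only if $\langle Q_{1}\gamma,\ldots,Q_{n}\gamma,^{\prime}\rangle=\mathscr{D}$.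
   Context: A TBA is a Boolean algebra with a unary operator $^{\prime}$ satisfying $0^{\prime}=0$, $(A\cup B)^{\prime}=A^{\prime}\cup B^{\prime}$, $A^{\prime\prime}\subseteq A^{\prime}$; an element $B$ is closed if $\overline{B}=B$ where $\overline{B}=B\cup B^{\prime}$. For a TBA and a set $\mathcal{A}$ of its elements, $\langle\mathcal{A},^{\prime}\rangle$ is the smallest Boolean subalgebra (containing $1$) containing $\mathcal{A}$ and closed under $^{\prime}$. A PO system is a set $P$ with an antisymmetric transitive relation $<$ (possibly $p<p$); $q\leqslant p$ means $q<p$ or $q=p$. A subset $L\subseteq P$ is a lower subset if $p\in L$ and $q<p$ imply $q\in L$. $(2^{P},^{\prime})$ is the TBA of all subsets of $P$ with $Q^{\prime}=\{p\in P\mid p<q\text{ for some }q\in Q\}$. -}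

module Defs where

open import Level using (Level; _⊔_) renaming (suc to lsuc)
open import Data.Bool using (Bool; true; false; if_then_else_)
import Data.Bool as 𝔹
open import Data.Nat using (ℕ; zero; suc)
open import Data.Fin using (Fin; zero; suc)
open import Data.Fin.Subset using (Subset; _∪_; _∩_; ∁)
import Data.Fin.Subset as Sub
open import Data.Fin.Subset.Properties using (∪-∩-booleanAlgebra)
open import Data.Vec using (Vec; lookup; tabulate)
open import Data.Product using (∃; _×_; _,_)
open import Data.Sum using (_⊎_)
open import Algebra.Core using (Op₁)
open import Algebra.Lattice.Bundles using (BooleanAlgebra)
open import Function.Bundles using (Bijection; _⇔_)
open import Relation.Binary.PropositionalEquality using (_≡_) renaming (setoid to ≡-setoid)

private variable c ℓ : Level

-- Topological Boolean algebras (TBA): a Boolean algebra with a unary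
-- operator ′ such that 0′ = 0, (A ∪ B)′ = A′ ∪ B′, A′′ ⊆ A′.
-- (a ≤ b is expressed as a ∧ b ≈ a.)

record TBA c ℓ : Set (lsuc (c ⊔ ℓ)) where
  field
    ba : BooleanAlgebra c ℓ
  open BooleanAlgebra ba public
  infix 9 _′
  field
    _′    : Carrier → Carrier
    ′-cong : ∀ {x y} → x ≈ y → x ′ ≈ y ′
    ′-⊥   : ⊥ ′ ≈ ⊥
    ′-∨   : ∀ x y → (x ∨ y) ′ ≈ (x ′) ∨ (y ′)
    ′′-≤′ : ∀ x → (x ′ ′) ∧ (x ′) ≈ x ′ ′

module _ (D : TBA c ℓ) where
  open TBA D

  Closed : Carrier → Set ℓ
  Closed x = (x ∨ x ′) ≈ x

  Atom : Carrier → Set (c ⊔ ℓ)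
  Atom a = (a ≈ ⊥ → Data.Empty.⊥) × (∀ b → (b ∧ a) ≈ b → (b ≈ ⊥) ⊎ (b ≈ a))
    where import Data.Empty

  Finite : Set (c ⊔ ℓ)
  Finite = ∃ λ n → Bijection (≡-setoid (Fin n)) setoid

  ⋁ : ∀ {m} → (Fin m → Carrier) → Carrier
  ⋁ {zero}  f = ⊥
  ⋁ {suc m} f = f zero ∨ ⋁ (λ i → f (suc i))

module _ (B : BooleanAlgebra c ℓ) where
  open BooleanAlgebra B

  data GenBA (S : Carrier → Set ℓ) : Carrier → Set (c ⊔ ℓ) where
    base : ∀ {x} → S x → GenBA S x
    top  : GenBA S ⊤
    bot  : GenBA S ⊥
    join : ∀ {x y} → GenBA S x → GenBA S y → GenBA S (x ∨ y)
    meet : ∀ {x y} → GenBA S x → GenBA S y → GenBA S (x ∧ y)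
    neg  : ∀ {x} → GenBA S x → GenBA S (¬ x)
    resp : ∀ {x y} → x ≈ y → GenBA S x → GenBA S y

  data GenTBA (d : Op₁ Carrier) (S : Carrier → Set ℓ) : Carrier → Set (c ⊔ ℓ) where
    base  : ∀ {x} → S x → GenTBA d S x
    top   : GenTBA d S ⊤
    bot   : GenTBA d S ⊥
    join  : ∀ {x y} → GenTBA d S x → GenTBA d S y → GenTBA d S (x ∨ y)
    meet  : ∀ {x y} → GenTBA d S x → GenTBA d S y → GenTBA d S (x ∧ y)
    neg   : ∀ {x} → GenTBA d S x → GenTBA d S (¬ x)
    deriv : ∀ {x} → GenTBA d S x → GenTBA d S (d x)
    resp  : ∀ {x y} → x ≈ y → GenTBA d S x → GenTBA d S y

GeneratedByClosed : (D : TBA c ℓ) → Set (c ⊔ ℓ)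
GeneratedByClosed D = ∀ x → GenBA (TBA.ba D) (Closed D) x

-- Finite PO systems, carried (w.l.o.g.) by Fin m, with a decidable
-- (Bool-valued) relation:  q < p  means  R q p ≡ true.
-- Antisymmetric and transitive; p < p is allowed.

IsPO : ∀ {m} → (Fin m → Fin m → Bool) → Set
IsPO R = (∀ p q → R p q ≡ true → R q p ≡ true → p ≡ q)
       × (∀ p q r → R p q ≡ true → R q r ≡ true → R p r ≡ true)

anyFin : ∀ {m} → (Fin m → Bool) → Bool
anyFin {zero}  f = false
anyFin {suc m} f = f zero 𝔹.∨ anyFin (λ i → f (suc i))

derivP : ∀ {m} → (Fin m → Fin m → Bool) → Subset m → Subset m
derivP R Q = tabulate (λ p → anyFin (λ q → R p q 𝔹.∧ lookup Q q))

IsLower : ∀ {m} → (Fin m → Fin m → Bool) → Subset m → Set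
IsLower R L = ∀ p q → lookup L p ≡ true → R q p ≡ true → lookup L q ≡ true

2^ : ℕ → BooleanAlgebra _ _
2^ m = ∪-∩-booleanAlgebra m

module _ (D : TBA c ℓ) {m : ℕ} (R : Fin m → Fin m → Bool) (X : Fin m → TBA.Carrier D) where
  open TBA D

  γ : Subset m → Carrier
  γ Q = ⋁ D (λ q → if lookup Q q then X q else ⊥)

  record Lemma3Conclusion : Set (c ⊔ ℓ) where
    field
      labels-atoms     : ∀ p → Atom D (X p)
      atoms-labelled   : ∀ a → Atom D a → ∃ λ p → a ≈ X p
      labels-injective : ∀ p q → X p ≈ X q → p ≡ q
      partition-deriv  : ∀ p → X p ′ ≈ ⋁ D (λ q → if R q p then X q else ⊥)
      γ-∨   : ∀ Q Q′ → γ (Q ∪ Q′) ≈ γ Q ∨ γ Q′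
      γ-∧   : ∀ Q Q′ → γ (Q ∩ Q′) ≈ γ Q ∧ γ Q′
      γ-¬   : ∀ Q → γ (∁ Q) ≈ ¬ γ Q
      γ-⊤   : γ Sub.⊤ ≈ ⊤
      γ-⊥   : γ Sub.⊥ ≈ ⊥
      γ-′   : ∀ Q → γ (derivP R Q) ≈ γ Q ′
      γ-injective  : ∀ Q Q′ → γ Q ≈ γ Q′ → Q ≡ Q′
      γ-surjective : ∀ x → ∃ λ Q → γ Q ≈ x
      lower⇔closed : ∀ Q → IsLower R Q ⇔ Closed D (γ Q)
      generation : ∀ n (Qs : Fin n → Subset m) → (∀ i → IsLower R (Qs i)) →
        (∀ Q → GenTBA (2^ m) (derivP R) (λ Q → ∃ λ i → Qs i ≡ Q) Q)
        ⇔ (∀ x → GenTBA ba _′ (λ x → ∃ λ i → γ (Qs i) ≈ x) x)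

module Submission where

-- The labels are the atoms X_p themselves, ordered by p < q iff X_p ≤ X_q′.  Every element of
-- the finite algebra D is the join of the atoms below it and ′ distributes over finite joins, so
-- X_q′ is the join of the X_p with p < q, and γ is an isomorphism of TBAs (2^P, ′) ≅ D, which
-- transports generated subalgebras in both directions.  Transitivity of < comes from A′′ ⊆ A′.
-- Antisymmetry is where generation by closed elements enters: if X_p ≤ X_q′ and X_q ≤ X_p′, a
-- closed element containing one of X_p, X_q contains the other, and since atoms are prime no
-- element of the Boolean algebra generated by the closed elements separates them.

open import Defs
open import Level using (Level; _⊔_)
open import Algebra.Core using (Op₁)
open import Algebra.Definitions using (Congruent₁)
open import Algebra.Lattice.Bundles using (BooleanAlgebra)
open import Data.Bool using (Bool; true; false; if_then_else_) renaming (_∧_ to _∧ᵇ_; _∨_ to _∨ᵇ_)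
open import Data.Bool.Properties using (T-≡; T-∨; T-∧)
open import Data.Empty using (⊥-elim)
open import Data.Fin using (Fin; zero; suc)
import Data.Fin.Properties as Fin
open import Data.Fin.Subset using (Subset; _∈_; _⊆_; _∪_; _∩_; ∁)
import Data.Fin.Subset as Subset
open import Data.Fin.Subset.Properties
  using (∪⇔⊎; ∩⇔×; x∈∁p⇒x∉p; x∉p⇒x∈∁p; ∈⊤; ∉⊥; ⊆-antisym)
open import Data.List using (List; _∷_; length; lookup; filter; allFin)
open import Data.List.Membership.Propositional.Properties
  using (∈-lookup; ∈-filter⁺; ∈-filter⁻; ∈-allFin)
import Data.List.Relation.Unary.All as All
import Data.List.Relation.Unary.Any as Any
open import Data.List.Relation.Unary.Any.Properties using (lookup-index)
open import Data.List.Relation.Unary.AllPairs using (_∷_)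
open import Data.List.Relation.Unary.Unique.Propositional using (Unique)
open import Data.List.Relation.Unary.Unique.Propositional.Properties using (filter⁺; allFin⁺)
open import Data.Nat using (ℕ; zero; suc)
open import Data.Product using (∃; _×_; _,_; proj₁; proj₂)
open import Data.Product.Function.Dependent.Propositional using (congˡ)
open import Data.Product.Function.NonDependent.Propositional using (_×-⇔_)
import Data.Sum as Sum
open import Data.Sum using (_⊎_; inj₁; inj₂; [_,_])
open import Data.Sum.Function.Propositional using (_⊎-⇔_)
open import Data.Vec using (tabulate) renaming (lookup to lookupᵛ)
open import Data.Vec.Properties using ([]=⇒lookup; lookup⇒[]=; lookup∘tabulate)
open import Function using (_∘_; id)
open import Function.Bundles using (_⇔_; mk⇔; Equivalence; Bijection)
open Equivalence using (to; from)
import Function.Properties.Equivalence as ⇔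
open import Function.Properties.Bijection using (Bijection⇒Inverse)
import Function.Properties.Inverse as Inverse
open import Function.Related.Propositional using (module EquationalReasoning)
open import Function.Related.TypeIsomorphisms using (¬-cong-⇔)
import Relation.Binary.Lattice as OrderLattice
open import Relation.Binary.Definitions using (Decidable)
open import Relation.Binary.PropositionalEquality as ≡ using (_≡_)
import Relation.Nullary as Nullary
open import Relation.Nullary.Decidable
  using (Dec; yes; no; does; map′; _×-dec_; _⊎-dec_; _→-dec_; ¬?; via-injection)

private variable c ℓ : Level

module BooleanAlgebraOrder (B : BooleanAlgebra c ℓ) where
  open BooleanAlgebra B
  open import Algebra.Lattice.Properties.BooleanAlgebra B
    using (∧-identityʳ; ∧-zeroʳ; ∨-identityʳ; ¬-involutive)
  open import Algebra.Lattice.Properties.Lattice lattice using (∨-∧-orderTheoreticLattice)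
  open import Relation.Binary.Reasoning.Setoid setoid

  open OrderLattice.Lattice ∨-∧-orderTheoreticLattice public
    using ( _≤_; x≤x∨y; y≤x∨y; ∨-least; x∧y≤x; x∧y≤y; ∧-greatest; antisym
          ; ≤-respˡ-≈; ≤-respʳ-≈; joinSemilattice)
    renaming (refl to ≤-refl; trans to ≤-trans; reflexive to ≤-reflexive)

  infix 4 _≰_
  _≰_ : Carrier → Carrier → Set ℓ
  x ≰ y = Nullary.¬ (x ≤ y)

  ≤-respˡ-⇔ : ∀ {x y z} → x ≈ y → x ≤ z ⇔ y ≤ z
  ≤-respˡ-⇔ x≈y = mk⇔ (≤-respˡ-≈ x≈y) (≤-respˡ-≈ (sym x≈y))

  ≤-respʳ-⇔ : ∀ {x y z} → y ≈ z → x ≤ y ⇔ x ≤ z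
  ≤-respʳ-⇔ y≈z = mk⇔ (≤-respʳ-≈ y≈z) (≤-respʳ-≈ (sym y≈z))

  x≤⊤ : ∀ x → x ≤ ⊤
  x≤⊤ x = sym (∧-identityʳ x)

  x≤⊥⇒x≈⊥ : ∀ {x} → x ≤ ⊥ → x ≈ ⊥
  x≤⊥⇒x≈⊥ {x} x≤⊥ = trans x≤⊥ (∧-zeroʳ x)

  x∧¬y≈⊥⇒x≤y : ∀ {x y} → x ∧ ¬ y ≈ ⊥ → x ≤ y
  x∧¬y≈⊥⇒x≤y {x} {y} x∧¬y≈⊥ = begin
    x                    ≈⟨ ∧-identityʳ x ⟨
    x ∧ ⊤                ≈⟨ ∧-congˡ (∨-complementʳ y) ⟨
    x ∧ (y ∨ ¬ y)        ≈⟨ ∧-distribˡ-∨ x y (¬ y) ⟩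
    (x ∧ y) ∨ (x ∧ ¬ y)  ≈⟨ ∨-congˡ x∧¬y≈⊥ ⟩
    (x ∧ y) ∨ ⊥          ≈⟨ ∨-identityʳ (x ∧ y) ⟩
    x ∧ y                ∎

  x∧y≈⊥⇒x≤¬y : ∀ {x y} → x ∧ y ≈ ⊥ → x ≤ ¬ y
  x∧y≈⊥⇒x≤¬y {x} {y} x∧y≈⊥ = x∧¬y≈⊥⇒x≤y (trans (∧-congˡ (¬-involutive y)) x∧y≈⊥)

  x≤y⇒x≤¬y⇒x≈⊥ : ∀ {x y} → x ≤ y → x ≤ ¬ y → x ≈ ⊥
  x≤y⇒x≤¬y⇒x≈⊥ {y = y} x≤y x≤¬y =
    x≤⊥⇒x≈⊥ (≤-respʳ-≈ (∧-complementʳ y) (∧-greatest x≤y x≤¬y))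

  x≤y⇒y∧z≈⊥⇒x∧z≈⊥ : ∀ {x y z} → x ≤ y → y ∧ z ≈ ⊥ → x ∧ z ≈ ⊥
  x≤y⇒y∧z≈⊥⇒x∧z≈⊥ {x} {y} {z} x≤y y∧z≈⊥ =
    x≤⊥⇒x≈⊥ (≤-respʳ-≈ y∧z≈⊥ (∧-greatest (≤-trans (x∧y≤x x z) x≤y) (x∧y≤y x z)))

  ≤-∧⇔ : ∀ {x y z} → x ≤ y ∧ z ⇔ (x ≤ y × x ≤ z)
  ≤-∧⇔ {x} {y} {z} =
    mk⇔ (λ x≤y∧z → ≤-trans x≤y∧z (x∧y≤x y z) , ≤-trans x≤y∧z (x∧y≤y y z))
        (λ (x≤y , x≤z) → ∧-greatest x≤y x≤z)

module TBAProperties (D : TBA c ℓ) where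
  open TBA D
  open BooleanAlgebraOrder ba
  open import Relation.Binary.Lattice.Properties.JoinSemilattice joinSemilattice
    using (x≤y⇒x∨y≈y)

  ′-mono : ∀ {x y} → x ≤ y → x ′ ≤ y ′
  ′-mono {x} {y} x≤y =
    ≤-respʳ-≈ (trans (sym (′-∨ x y)) (′-cong (x≤y⇒x∨y≈y x≤y))) (x≤x∨y (x ′) (y ′))

  ′′≤′ : ∀ x → x ′ ′ ≤ x ′
  ′′≤′ x = sym (′′-≤′ x)

  closed⇔′≤ : ∀ {x} → Closed D x ⇔ x ′ ≤ x
  closed⇔′≤ {x} = mk⇔ (λ closed → ≤-respʳ-≈ closed (y≤x∨y x (x ′)))
                      (λ x′≤x → antisym (∨-least ≤-refl x′≤x) (x≤x∨y x (x ′)))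

  ≤-⋁ : ∀ {m} (g : Fin m → Carrier) i → g i ≤ ⋁ D g
  ≤-⋁ g zero    = x≤x∨y _ _
  ≤-⋁ g (suc i) = ≤-trans (≤-⋁ (g ∘ suc) i) (y≤x∨y _ _)

  ⋁-cong : ∀ {m} {g h : Fin m → Carrier} → (∀ i → g i ≈ h i) → ⋁ D g ≈ ⋁ D h
  ⋁-cong {zero}  g≈h = refl
  ⋁-cong {suc m} g≈h = ∨-cong (g≈h zero) (⋁-cong (g≈h ∘ suc))

  ′-⋁ : ∀ {m} (g : Fin m → Carrier) → ⋁ D g ′ ≈ ⋁ D (λ i → g i ′)
  ′-⋁ {zero}  g = ′-⊥
  ′-⋁ {suc m} g = trans (′-∨ _ _) (∨-congˡ (′-⋁ (g ∘ suc)))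

  ⋁-restricted : ∀ {m} → (Fin m → Bool) → (Fin m → Carrier) → Carrier
  ⋁-restricted b g = ⋁ D (λ q → if b q then g q else ⊥)

  ′-⋁-restricted : ∀ {m} (b : Fin m → Bool) (g : Fin m → Carrier) →
                   ⋁-restricted b g ′ ≈ ⋁-restricted b (λ q → g q ′)
  ′-⋁-restricted b g = trans (′-⋁ (λ q → if b q then g q else ⊥)) (⋁-cong λ q → ′-if (b q))
    where
    ′-if : ∀ {y} bq → (if bq then y else ⊥) ′ ≈ (if bq then y ′ else ⊥)
    ′-if true  = refl
    ′-if false = ′-⊥

  ≤-⋁-restricted : ∀ {m} (b : Fin m → Bool) (g : Fin m → Carrier) {q} →
                   b q ≡ true → g q ≤ ⋁-restricted b g
  ≤-⋁-restricted b g {q} bq = ≤-respˡ-≈ (reflexive (≡.cong (if_then g q else ⊥) bq)) (≤-⋁ _ q)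

  module _ {a} (atom : Atom D a) where

    atom≰⊥ : a ≰ ⊥
    atom≰⊥ = proj₁ atom ∘ x≤⊥⇒x≈⊥

    atom-≤⊎≤¬ : ∀ x → a ≤ x ⊎ a ≤ ¬ x
    atom-≤⊎≤¬ x with proj₂ atom (a ∧ x) (sym (x∧y≤x a x))
    ... | inj₁ a∧x≈⊥ = inj₂ (x∧y≈⊥⇒x≤¬y a∧x≈⊥)
    ... | inj₂ a∧x≈a = inj₁ (sym a∧x≈a)

    atom-≤¬⇔≰ : ∀ {x} → a ≤ ¬ x ⇔ a ≰ x
    atom-≤¬⇔≰ {x} = mk⇔ (λ a≤¬x a≤x → proj₁ atom (x≤y⇒x≤¬y⇒x≈⊥ a≤x a≤¬x))
                         (λ a≰x → [ ⊥-elim ∘ a≰x , id ] (atom-≤⊎≤¬ x))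

    atom-≤∨⇔ : ∀ {x y} → a ≤ x ∨ y ⇔ (a ≤ x ⊎ a ≤ y)
    atom-≤∨⇔ {x} {y} = mk⇔ split [ (λ a≤x → ≤-trans a≤x (x≤x∨y x y))
                                 , (λ a≤y → ≤-trans a≤y (y≤x∨y x y)) ]
      where
      open import Algebra.Lattice.Properties.BooleanAlgebra ba using (deMorgan₂)

      split : a ≤ x ∨ y → a ≤ x ⊎ a ≤ y
      split a≤x∨y with atom-≤⊎≤¬ x | atom-≤⊎≤¬ y
      ... | inj₁ a≤x  | _         = inj₁ a≤x
      ... | inj₂ _    | inj₁ a≤y  = inj₂ a≤y
      ... | inj₂ a≤¬x | inj₂ a≤¬y = ⊥-elim (proj₁ atom (x≤y⇒x≤¬y⇒x≈⊥ a≤x∨y a≤¬[x∨y]))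
        where a≤¬[x∨y] = ≤-respʳ-≈ (sym (deMorgan₂ x y)) (∧-greatest a≤¬x a≤¬y)

    atom-≤⋁⇒ : ∀ {m} (g : Fin m → Carrier) → a ≤ ⋁ D g → ∃ λ i → a ≤ g i
    atom-≤⋁⇒ {zero}  g a≤⊥ = ⊥-elim (atom≰⊥ a≤⊥)
    atom-≤⋁⇒ {suc m} g a≤⋁ with to atom-≤∨⇔ a≤⋁
    ... | inj₁ a≤g₀    = zero , a≤g₀
    ... | inj₂ a≤⋁rest = let (i , a≤gi) = atom-≤⋁⇒ (g ∘ suc) a≤⋁rest in suc i , a≤gi

    atom-≤⋁-restricted⇔ : ∀ {m} (b : Fin m → Bool) (g : Fin m → Carrier) →
                          a ≤ ⋁-restricted b g ⇔ (∃ λ q → a ≤ g q × b q ≡ true)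
    atom-≤⋁-restricted⇔ b g =
      mk⇔ below (λ (q , a≤gq , bq) → ≤-trans a≤gq (≤-⋁-restricted b g bq))
      where
      selected : ∀ {y} bq → a ≤ (if bq then y else ⊥) → a ≤ y × bq ≡ true
      selected true  a≤y = a≤y , ≡.refl
      selected false a≤⊥ = ⊥-elim (atom≰⊥ a≤⊥)

      below : a ≤ ⋁-restricted b g → ∃ λ q → a ≤ g q × b q ≡ true
      below a≤⋁ = let (q , a≤gq) = atom-≤⋁⇒ _ a≤⋁ in q , selected (b q) a≤gq

  atom≤atom⇒≈ : ∀ {a b} → Atom D a → Atom D b → a ≤ b → a ≈ b
  atom≤atom⇒≈ atom-a atom-b a≤b = [ ⊥-elim ∘ proj₁ atom-a , id ] (proj₂ atom-b _ (sym a≤b))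

  atom-resp-≈ : ∀ {a b} → a ≈ b → Atom D a → Atom D b
  atom-resp-≈ a≈b (a≉⊥ , a-minimal) =
    a≉⊥ ∘ trans a≈b ,
    λ x x∧b≈x → Sum.map₂ (λ x≈a → trans x≈a a≈b) (a-minimal x (trans (∧-congˡ a≈b) x∧b≈x))

  module _ {a b} (atom-a : Atom D a) (atom-b : Atom D b) (a≤b′ : a ≤ b ′) (b≤a′ : b ≤ a ′) where

    closed-generated-inseparable : ∀ {x} → GenBA ba (Closed D) x → a ≤ x ⇔ b ≤ x
    closed-generated-inseparable (base closed) =
      mk⇔ (λ a≤x → ≤-trans b≤a′ (≤-trans (′-mono a≤x) (to closed⇔′≤ closed)))
          (λ b≤x → ≤-trans a≤b′ (≤-trans (′-mono b≤x) (to closed⇔′≤ closed)))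
    closed-generated-inseparable top = mk⇔ (λ _ → x≤⊤ b) (λ _ → x≤⊤ a)
    closed-generated-inseparable bot = mk⇔ (⊥-elim ∘ atom≰⊥ atom-a) (⊥-elim ∘ atom≰⊥ atom-b)
    closed-generated-inseparable (join gx gy) =
      ⇔.trans (atom-≤∨⇔ atom-a)
        (⇔.trans (closed-generated-inseparable gx ⊎-⇔ closed-generated-inseparable gy)
                 (⇔.sym (atom-≤∨⇔ atom-b)))
    closed-generated-inseparable (meet gx gy) =
      ⇔.trans ≤-∧⇔
        (⇔.trans (closed-generated-inseparable gx ×-⇔ closed-generated-inseparable gy)
                 (⇔.sym ≤-∧⇔))
    closed-generated-inseparable (neg gx) =
      ⇔.trans (atom-≤¬⇔≰ atom-a)
        (⇔.trans (¬-cong-⇔ (closed-generated-inseparable gx)) (⇔.sym (atom-≤¬⇔≰ atom-b)))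
    closed-generated-inseparable (resp x≈y gx) =
      ⇔.trans (≤-respʳ-⇔ (sym x≈y)) (⇔.trans (closed-generated-inseparable gx) (≤-respʳ-⇔ x≈y))

lookup-injective : ∀ {a} {A : Set a} {xs : List A} → Unique xs →
                   ∀ i j → lookup xs i ≡ lookup xs j → i ≡ j
lookup-injective (_ ∷ _)      zero    zero    _  = ≡.refl
lookup-injective (x∉xs ∷ _)   zero    (suc j) eq = ⊥-elim (All.lookup x∉xs (∈-lookup j) eq)
lookup-injective (y∉xs ∷ _)   (suc i) zero    eq = ⊥-elim (All.lookup y∉xs (∈-lookup i) (≡.sym eq))
lookup-injective (_ ∷ unique) (suc i) (suc j) eq = ≡.cong suc (lookup-injective unique i j eq)

does≡true⇔ : ∀ {a} {A : Set a} (a? : Dec A) → does a? ≡ true ⇔ A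
does≡true⇔ (yes a) = mk⇔ (λ _ → a) (λ _ → ≡.refl)
does≡true⇔ (no ¬a) = mk⇔ (λ ()) (⊥-elim ∘ ¬a)

∨≡true⇔ : ∀ {x y} → x ∨ᵇ y ≡ true ⇔ (x ≡ true ⊎ y ≡ true)
∨≡true⇔ = ⇔.trans (⇔.sym T-≡) (⇔.trans T-∨ (T-≡ ⊎-⇔ T-≡))

∧≡true⇔ : ∀ {x y} → x ∧ᵇ y ≡ true ⇔ (x ≡ true × y ≡ true)
∧≡true⇔ = ⇔.trans (⇔.sym T-≡) (⇔.trans T-∧ (T-≡ ×-⇔ T-≡))

anyFin≡true⇔ : ∀ {m} (f : Fin m → Bool) → anyFin f ≡ true ⇔ ∃ λ i → f i ≡ true
anyFin≡true⇔ {zero}  f = mk⇔ (λ ()) (λ ())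
anyFin≡true⇔ {suc m} f =
  ⇔.trans ∨≡true⇔ (⇔.trans (⇔.refl ⊎-⇔ anyFin≡true⇔ (f ∘ suc)) Fin.⊎⇔∃)

∈⇔lookup≡true : ∀ {m} (Q : Subset m) {p} → p ∈ Q ⇔ lookupᵛ Q p ≡ true
∈⇔lookup≡true Q {p} = mk⇔ []=⇒lookup (lookup⇒[]= p Q)

module _ {m} (R : Fin m → Fin m → Bool) where

  ∈-derivP⇔ : ∀ {Q p} → p ∈ derivP R Q ⇔ ∃ λ q → R p q ≡ true × q ∈ Q
  ∈-derivP⇔ {Q} {p} = begin
    p ∈ derivP R Q                              ∼⟨ ∈⇔lookup≡true (derivP R Q) ⟩
    lookupᵛ (derivP R Q) p ≡ true               ≡⟨ ≡.cong (_≡ true) (lookup∘tabulate _ p) ⟩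
    anyFin (λ q → R p q ∧ᵇ lookupᵛ Q q) ≡ true  ∼⟨ anyFin≡true⇔ _ ⟩
    ∃ (λ q → R p q ∧ᵇ lookupᵛ Q q ≡ true)       ∼⟨ congˡ ∧≡true⇔ ⟩
    ∃ (λ q → R p q ≡ true × lookupᵛ Q q ≡ true) ∼⟨ congˡ (⇔.refl ×-⇔ ⇔.sym (∈⇔lookup≡true Q)) ⟩
    ∃ (λ q → R p q ≡ true × q ∈ Q)              ∎
    where open EquationalReasoning

  lower⇔derivP⊆ : ∀ {Q} → IsLower R Q ⇔ derivP R Q ⊆ Q
  lower⇔derivP⊆ {Q} = mk⇔ derivP⊆ lower
    where
    derivP⊆ : IsLower R Q → derivP R Q ⊆ Q
    derivP⊆ isLower q∈Q′ =
      let (p , qRp , p∈Q) = to ∈-derivP⇔ q∈Q′ in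
      from (∈⇔lookup≡true Q) (isLower p _ (to (∈⇔lookup≡true Q) p∈Q) qRp)

    lower : derivP R Q ⊆ Q → IsLower R Q
    lower Q′⊆Q p q Qp qRp =
      to (∈⇔lookup≡true Q) (Q′⊆Q (from ∈-derivP⇔ (p , qRp , from (∈⇔lookup≡true Q) Qp)))

module FiniteTBA (D : TBA c ℓ) (finite : Finite D) where
  open TBA D
  open BooleanAlgebraOrder ba
  open TBAProperties D

  private
    n : ℕ
    n = proj₁ finite

    open Bijection (proj₂ finite) using (injective; strictlySurjective) renaming (to to element)

    index : Carrier → Fin n
    index x = proj₁ (strictlySurjective x)

    element-index : ∀ x → element (index x) ≈ x
    element-index x = proj₂ (strictlySurjective x)

  infix 4 _≈?_ _≤?_

  _≈?_ : Decidable _≈_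
  _≈?_ = via-injection (Inverse.Inverse⇒Injection (Inverse.sym (Bijection⇒Inverse (proj₂ finite))))
                       Fin._≟_

  _≤?_ : Decidable _≤_
  x ≤? y = x ≈? (x ∧ y)

  atom? : ∀ x → Dec (Atom D x)
  atom? x = map′ (λ (x≉⊥ , minimal) → x≉⊥ , minimal-everywhere minimal)
                 (λ (x≉⊥ , minimal) → x≉⊥ , minimal ∘ element)
                 (¬? (x ≈? ⊥) ×-dec Fin.all? λ i →
                    (element i ∧ x ≈? element i) →-dec (element i ≈? ⊥ ⊎-dec element i ≈? x))
    where
    minimal-everywhere : (∀ i → element i ∧ x ≈ element i → element i ≈ ⊥ ⊎ element i ≈ x) →
                         ∀ y → y ∧ x ≈ y → y ≈ ⊥ ⊎ y ≈ x
    minimal-everywhere minimal y y∧x≈y =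
      Sum.map (trans (sym (element-index y))) (trans (sym (element-index y)))
        (minimal (index y) (trans (∧-congʳ (element-index y)) (trans y∧x≈y (sym (element-index y)))))

  Decides : Carrier → Carrier → Set ℓ
  Decides r y = r ≤ y ⊎ r ∧ y ≈ ⊥

  ∃-deciding-below : ∀ {k} (g : Fin k → Carrier) {z} → z ≉ ⊥ →
                     ∃ λ r → r ≤ z × r ≉ ⊥ × ∀ i → Decides r (g i)
  ∃-deciding-below {zero}  g {z} z≉⊥ = z , ≤-refl , z≉⊥ , λ ()
  ∃-deciding-below {suc k} g {z} z≉⊥ with z ∧ g zero ≈? ⊥
  ... | yes z∧g₀≈⊥ =
    let (r , r≤z , r≉⊥ , decides) = ∃-deciding-below (g ∘ suc) z≉⊥ in
    r , r≤z , r≉⊥ , λ { zero → inj₂ (x≤y⇒y∧z≈⊥⇒x∧z≈⊥ r≤z z∧g₀≈⊥) ; (suc i) → decides i }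
  ... | no z∧g₀≉⊥ =
    let (r , r≤z∧g₀ , r≉⊥ , decides) = ∃-deciding-below (g ∘ suc) z∧g₀≉⊥ in
    r , ≤-trans r≤z∧g₀ (x∧y≤x z (g zero)) , r≉⊥ ,
    λ { zero → inj₁ (≤-trans r≤z∧g₀ (x∧y≤y z (g zero))) ; (suc i) → decides i }

  deciding-all⇒atom : ∀ {r} → r ≉ ⊥ → (∀ y → Decides r y) → Atom D r
  deciding-all⇒atom {r} r≉⊥ decides = r≉⊥ , minimal
    where
    minimal : ∀ y → y ∧ r ≈ y → y ≈ ⊥ ⊎ y ≈ r
    minimal y y∧r≈y with decides y
    ... | inj₁ r≤y   = inj₂ (antisym (sym y∧r≈y) r≤y)
    ... | inj₂ r∧y≈⊥ = inj₁ (trans (sym y∧r≈y) (trans (∧-comm y r) r∧y≈⊥))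

  ∃-atom-below : ∀ {z} → z ≉ ⊥ → ∃ λ a → Atom D a × a ≤ z
  ∃-atom-below z≉⊥ =
    let (r , r≤z , r≉⊥ , decides) = ∃-deciding-below element z≉⊥ in
    r , deciding-all⇒atom r≉⊥ (λ y → decides-≈ (element-index y) (decides (index y))) , r≤z
    where
    decides-≈ : ∀ {r y y′} → y ≈ y′ → Decides r y → Decides r y′
    decides-≈ y≈y′ = Sum.map (≤-respʳ-≈ y≈y′) (trans (∧-congˡ (sym y≈y′)))

  private
    atomIndices : List (Fin n)
    atomIndices = filter (atom? ∘ element) (allFin n)

  m : ℕ
  m = length atomIndices

  X : Fin m → Carrier
  X = element ∘ lookup atomIndices

  X-atom : ∀ p → Atom D (X p)
  X-atom p = proj₂ (∈-filter⁻ (atom? ∘ element) {xs = allFin n} (∈-lookup p))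

  X-injective : ∀ p q → X p ≈ X q → p ≡ q
  X-injective p q Xp≈Xq =
    lookup-injective (filter⁺ (atom? ∘ element) (allFin⁺ n)) p q (injective Xp≈Xq)

  atom⇒≈X : ∀ {a} → Atom D a → ∃ λ p → a ≈ X p
  atom⇒≈X {a} atom =
    Any.index a∈atoms ,
    trans (sym (element-index a)) (reflexive (≡.cong element (lookup-index a∈atoms)))
    where
    a∈atoms = ∈-filter⁺ (atom? ∘ element) (∈-allFin (index a))
                        (atom-resp-≈ (sym (element-index a)) atom)

  X≤X⇒≡ : ∀ {p q} → X p ≤ X q → p ≡ q
  X≤X⇒≡ {p} {q} Xp≤Xq = X-injective p q (atom≤atom⇒≈ (X-atom p) (X-atom q) Xp≤Xq)

  ≤-by-atoms : ∀ {x y} → (∀ p → X p ≤ x → X p ≤ y) → x ≤ y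
  ≤-by-atoms {x} {y} below with x ∧ ¬ y ≈? ⊥
  ... | yes x∧¬y≈⊥ = x∧¬y≈⊥⇒x≤y x∧¬y≈⊥
  ... | no x∧¬y≉⊥ =
    let (a , atom , a≤x∧¬y) = ∃-atom-below x∧¬y≉⊥
        (p , a≈Xp)          = atom⇒≈X atom
        Xp≤x∧¬y             = ≤-respˡ-≈ a≈Xp a≤x∧¬y
    in ⊥-elim (proj₁ (X-atom p) (x≤y⇒x≤¬y⇒x≈⊥ (below p (≤-trans Xp≤x∧¬y (x∧y≤x x (¬ y))))
                                              (≤-trans Xp≤x∧¬y (x∧y≤y x (¬ y)))))

  ≈-by-atoms : ∀ {x y} → (∀ p → X p ≤ x ⇔ X p ≤ y) → x ≈ y
  ≈-by-atoms same = antisym (≤-by-atoms (to ∘ same)) (≤-by-atoms (from ∘ same))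

record IsTBAIsomorphism {a ℓa b ℓb}
         (A : BooleanAlgebra a ℓa) (dA : Op₁ (BooleanAlgebra.Carrier A))
         (B : BooleanAlgebra b ℓb) (dB : Op₁ (BooleanAlgebra.Carrier B))
         (h : BooleanAlgebra.Carrier A → BooleanAlgebra.Carrier B) : Set (a ⊔ ℓa ⊔ b ⊔ ℓb) where
  private
    module A = BooleanAlgebra A
    module B = BooleanAlgebra B
  field
    cong       : ∀ {x y} → x A.≈ y → h x B.≈ h y
    ∨-homo     : ∀ x y → h (x A.∨ y) B.≈ h x B.∨ h y
    ∧-homo     : ∀ x y → h (x A.∧ y) B.≈ h x B.∧ h y
    ¬-homo     : ∀ x → h (A.¬ x) B.≈ B.¬ h x
    ⊤-homo     : h A.⊤ B.≈ B.⊤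
    ⊥-homo     : h A.⊥ B.≈ B.⊥
    d-homo     : ∀ x → h (dA x) B.≈ dB (h x)
    injective  : ∀ {x y} → h x B.≈ h y → x A.≈ y
    surjective : ∀ y → ∃ λ x → h x B.≈ y

module _ {a ℓa b ℓb}
         {A : BooleanAlgebra a ℓa} {dA : Op₁ (BooleanAlgebra.Carrier A)}
         {B : BooleanAlgebra b ℓb} {dB : Op₁ (BooleanAlgebra.Carrier B)}
         (dB-cong : Congruent₁ (BooleanAlgebra._≈_ B) dB)
         {h : BooleanAlgebra.Carrier A → BooleanAlgebra.Carrier B} (iso : IsTBAIsomorphism A dA B dB h)
         {I : Set} (g : I → BooleanAlgebra.Carrier A) where
  private
    module A = BooleanAlgebra A
    module B = BooleanAlgebra B
    open IsTBAIsomorphism iso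

    Generators : A.Carrier → Set ℓa
    Generators x = ∃ λ i → g i A.≈ x

    Generators′ : B.Carrier → Set ℓb
    Generators′ y = ∃ λ i → h (g i) B.≈ y

    image : ∀ {x} → GenTBA A dA Generators x → GenTBA B dB Generators′ (h x)
    image (base (i , gi≈x)) = base (i , cong gi≈x)
    image top               = resp (B.sym ⊤-homo) top
    image bot               = resp (B.sym ⊥-homo) bot
    image (join gx gy)      = resp (B.sym (∨-homo _ _)) (join (image gx) (image gy))
    image (meet gx gy)      = resp (B.sym (∧-homo _ _)) (meet (image gx) (image gy))
    image (neg gx)          = resp (B.sym (¬-homo _)) (neg (image gx))
    image (deriv gx)        = resp (B.sym (d-homo _)) (deriv (image gx))
    image (resp x≈y gx)     = resp (cong x≈y) (image gx)

    preimage : ∀ {y} → GenTBA B dB Generators′ y → ∀ x → h x B.≈ y → GenTBA A dA Generators x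
    preimage (base (i , hgi≈y)) x hx≈y = base (i , injective (B.trans hgi≈y (B.sym hx≈y)))
    preimage top x hx≈⊤ = resp (injective (B.trans ⊤-homo (B.sym hx≈⊤))) top
    preimage bot x hx≈⊥ = resp (injective (B.trans ⊥-homo (B.sym hx≈⊥))) bot
    preimage (join {y₁} {y₂} gy₁ gy₂) x hx≈y =
      let (x₁ , hx₁≈y₁) = surjective y₁ ; (x₂ , hx₂≈y₂) = surjective y₂ in
      resp (injective (B.trans (∨-homo x₁ x₂) (B.trans (B.∨-cong hx₁≈y₁ hx₂≈y₂) (B.sym hx≈y))))
           (join (preimage gy₁ x₁ hx₁≈y₁) (preimage gy₂ x₂ hx₂≈y₂))
    preimage (meet {y₁} {y₂} gy₁ gy₂) x hx≈y =
      let (x₁ , hx₁≈y₁) = surjective y₁ ; (x₂ , hx₂≈y₂) = surjective y₂ in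
      resp (injective (B.trans (∧-homo x₁ x₂) (B.trans (B.∧-cong hx₁≈y₁ hx₂≈y₂) (B.sym hx≈y))))
           (meet (preimage gy₁ x₁ hx₁≈y₁) (preimage gy₂ x₂ hx₂≈y₂))
    preimage (neg {y₁} gy₁) x hx≈y =
      let (x₁ , hx₁≈y₁) = surjective y₁ in
      resp (injective (B.trans (¬-homo x₁) (B.trans (B.¬-cong hx₁≈y₁) (B.sym hx≈y))))
           (neg (preimage gy₁ x₁ hx₁≈y₁))
    preimage (deriv {y₁} gy₁) x hx≈y =
      let (x₁ , hx₁≈y₁) = surjective y₁ in
      resp (injective (B.trans (d-homo x₁) (B.trans (dB-cong hx₁≈y₁) (B.sym hx≈y))))
           (deriv (preimage gy₁ x₁ hx₁≈y₁))
    preimage (resp y≈y′ gy) x hx≈y′ = preimage gy x (B.trans hx≈y′ (B.sym y≈y′))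

  generation-transport : (∀ x → GenTBA A dA Generators x) ⇔ (∀ y → GenTBA B dB Generators′ y)
  generation-transport =
    mk⇔ (λ generated y → let (x , hx≈y) = surjective y in resp hx≈y (image (generated x)))
        (λ generated′ x → preimage (generated′ (h x)) x B.refl)

module AtomicRepresentation (D : TBA c ℓ) (finite : Finite D) where
  open TBA D
  open BooleanAlgebraOrder ba
  open TBAProperties D
  open FiniteTBA D finite

  R : Fin m → Fin m → Bool
  R p q = does (X p ≤? X q ′)

  R≡true⇔ : ∀ {p q} → R p q ≡ true ⇔ X p ≤ X q ′
  R≡true⇔ {p} {q} = does≡true⇔ (X p ≤? X q ′)

  R-transitive : ∀ p q r → R p q ≡ true → R q r ≡ true → R p r ≡ true
  R-transitive p q r pRq qRr =
    from R≡true⇔ (≤-trans (to R≡true⇔ pRq) (≤-trans (′-mono (to R≡true⇔ qRr)) (′′≤′ (X r))))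

  R-antisymmetric : GeneratedByClosed D → ∀ p q → R p q ≡ true → R q p ≡ true → p ≡ q
  R-antisymmetric generated p q pRq qRp = X≤X⇒≡ (from X-inseparable ≤-refl)
    where
    X-inseparable = closed-generated-inseparable (X-atom p) (X-atom q) (to R≡true⇔ pRq)
                                                 (to R≡true⇔ qRp) (generated (X q))

  X≤⋁-restricted-X⇔ : ∀ (b : Fin m → Bool) p → X p ≤ ⋁-restricted b X ⇔ b p ≡ true
  X≤⋁-restricted-X⇔ b p = ⇔.trans (atom-≤⋁-restricted⇔ (X-atom p) b X)
    (mk⇔ (λ (q , Xp≤Xq , bq) → ≡.subst (λ r → b r ≡ true) (≡.sym (X≤X⇒≡ Xp≤Xq)) bq)
         (λ bp → p , ≤-refl , bp))

  partition : ∀ p → X p ′ ≈ ⋁-restricted (λ q → R q p) X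
  partition p =
    ≈-by-atoms λ q → ⇔.trans (⇔.sym R≡true⇔) (⇔.sym (X≤⋁-restricted-X⇔ (λ r → R r p) q))

  ⟦_⟧ : Subset m → Carrier
  ⟦_⟧ = γ D R X

  ∈⇔X≤⟦⟧ : ∀ Q {p} → p ∈ Q ⇔ X p ≤ ⟦ Q ⟧
  ∈⇔X≤⟦⟧ Q {p} = ⇔.trans (∈⇔lookup≡true Q) (⇔.sym (X≤⋁-restricted-X⇔ (lookupᵛ Q) p))

  ⟦⟧-≈ : ∀ {Q x} → (∀ p → p ∈ Q ⇔ X p ≤ x) → ⟦ Q ⟧ ≈ x
  ⟦⟧-≈ {Q} same = ≈-by-atoms λ p → ⇔.trans (⇔.sym (∈⇔X≤⟦⟧ Q)) (same p)

  ⟦⟧-∪ : ∀ Q Q′ → ⟦ Q ∪ Q′ ⟧ ≈ ⟦ Q ⟧ ∨ ⟦ Q′ ⟧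
  ⟦⟧-∪ Q Q′ = ⟦⟧-≈ λ p →
    ⇔.trans ∪⇔⊎ (⇔.trans (∈⇔X≤⟦⟧ Q ⊎-⇔ ∈⇔X≤⟦⟧ Q′) (⇔.sym (atom-≤∨⇔ (X-atom p))))

  ⟦⟧-∩ : ∀ Q Q′ → ⟦ Q ∩ Q′ ⟧ ≈ ⟦ Q ⟧ ∧ ⟦ Q′ ⟧
  ⟦⟧-∩ Q Q′ = ⟦⟧-≈ λ p → ⇔.trans ∩⇔× (⇔.trans (∈⇔X≤⟦⟧ Q ×-⇔ ∈⇔X≤⟦⟧ Q′) (⇔.sym ≤-∧⇔))

  ⟦⟧-∁ : ∀ Q → ⟦ ∁ Q ⟧ ≈ ¬ ⟦ Q ⟧
  ⟦⟧-∁ Q = ⟦⟧-≈ λ p →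
    ⇔.trans (mk⇔ x∈∁p⇒x∉p x∉p⇒x∈∁p)
            (⇔.trans (¬-cong-⇔ (∈⇔X≤⟦⟧ Q)) (⇔.sym (atom-≤¬⇔≰ (X-atom p))))

  ⟦⟧-⊤ : ⟦ Subset.⊤ ⟧ ≈ ⊤
  ⟦⟧-⊤ = ⟦⟧-≈ λ p → mk⇔ (λ _ → x≤⊤ (X p)) (λ _ → ∈⊤)

  ⟦⟧-⊥ : ⟦ Subset.⊥ ⟧ ≈ ⊥
  ⟦⟧-⊥ = ⟦⟧-≈ λ p → mk⇔ (⊥-elim ∘ ∉⊥) (⊥-elim ∘ atom≰⊥ (X-atom p))

  ⟦⟧-derivP : ∀ Q → ⟦ derivP R Q ⟧ ≈ ⟦ Q ⟧ ′
  ⟦⟧-derivP Q = ⟦⟧-≈ λ p → begin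
    p ∈ derivP R Q                                ∼⟨ ∈-derivP⇔ R ⟩
    ∃ (λ q → R p q ≡ true × q ∈ Q)                ∼⟨ congˡ (R≡true⇔ ×-⇔ ∈⇔lookup≡true Q) ⟩
    ∃ (λ q → X p ≤ X q ′ × lookupᵛ Q q ≡ true)    ∼⟨ ⇔.sym (atom-≤⋁-restricted⇔ (X-atom p) _ _) ⟩
    X p ≤ ⋁-restricted (lookupᵛ Q) (λ q → X q ′)  ∼⟨ ≤-respʳ-⇔ (sym (′-⋁-restricted (lookupᵛ Q) X)) ⟩
    X p ≤ ⟦ Q ⟧ ′                                 ∎
    where open EquationalReasoning

  ⊆⇔⟦⟧≤ : ∀ {Q Q′} → Q ⊆ Q′ ⇔ ⟦ Q ⟧ ≤ ⟦ Q′ ⟧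
  ⊆⇔⟦⟧≤ {Q} {Q′} = mk⇔
    (λ Q⊆Q′ → ≤-by-atoms λ p Xp≤⟦Q⟧ → to (∈⇔X≤⟦⟧ Q′) (Q⊆Q′ (from (∈⇔X≤⟦⟧ Q) Xp≤⟦Q⟧)))
    (λ ⟦Q⟧≤⟦Q′⟧ {p} p∈Q → from (∈⇔X≤⟦⟧ Q′) (≤-trans (to (∈⇔X≤⟦⟧ Q {p}) p∈Q) ⟦Q⟧≤⟦Q′⟧))

  ⟦⟧-injective : ∀ {Q Q′} → ⟦ Q ⟧ ≈ ⟦ Q′ ⟧ → Q ≡ Q′
  ⟦⟧-injective ⟦Q⟧≈⟦Q′⟧ =
    ⊆-antisym (from ⊆⇔⟦⟧≤ (≤-reflexive ⟦Q⟧≈⟦Q′⟧)) (from ⊆⇔⟦⟧≤ (≤-reflexive (sym ⟦Q⟧≈⟦Q′⟧)))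

  ⟦⟧-surjective : ∀ x → ∃ λ Q → ⟦ Q ⟧ ≈ x
  ⟦⟧-surjective x = Q , ⟦⟧-≈ λ p → begin
    p ∈ Q                   ∼⟨ ∈⇔lookup≡true Q ⟩
    lookupᵛ Q p ≡ true      ≡⟨ ≡.cong (_≡ true) (lookup∘tabulate _ p) ⟩
    does (X p ≤? x) ≡ true  ∼⟨ does≡true⇔ (X p ≤? x) ⟩
    X p ≤ x                 ∎
    where
    open EquationalReasoning
    Q : Subset m
    Q = tabulate λ p → does (X p ≤? x)

  lower⇔closed : ∀ Q → IsLower R Q ⇔ Closed D ⟦ Q ⟧
  lower⇔closed Q = begin
    IsLower R Q             ∼⟨ lower⇔derivP⊆ R ⟩
    derivP R Q ⊆ Q          ∼⟨ ⊆⇔⟦⟧≤ ⟩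
    ⟦ derivP R Q ⟧ ≤ ⟦ Q ⟧  ∼⟨ ≤-respˡ-⇔ (⟦⟧-derivP Q) ⟩
    ⟦ Q ⟧ ′ ≤ ⟦ Q ⟧         ∼⟨ ⇔.sym closed⇔′≤ ⟩
    Closed D ⟦ Q ⟧          ∎
    where open EquationalReasoning

  ⟦⟧-isTBAIsomorphism : IsTBAIsomorphism (2^ m) (derivP R) ba _′ ⟦_⟧
  ⟦⟧-isTBAIsomorphism = record
    { cong       = reflexive ∘ ≡.cong ⟦_⟧
    ; ∨-homo     = ⟦⟧-∪
    ; ∧-homo     = ⟦⟧-∩
    ; ¬-homo     = ⟦⟧-∁
    ; ⊤-homo     = ⟦⟧-⊤
    ; ⊥-homo     = ⟦⟧-⊥
    ; d-homo     = ⟦⟧-derivP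
    ; injective  = ⟦⟧-injective
    ; surjective = ⟦⟧-surjective
    }

  conclusion : Lemma3Conclusion D R X
  conclusion = record
    { labels-atoms     = X-atom
    ; atoms-labelled   = λ _ → atom⇒≈X
    ; labels-injective = X-injective
    ; partition-deriv  = partition
    ; γ-∨              = ⟦⟧-∪
    ; γ-∧              = ⟦⟧-∩
    ; γ-¬              = ⟦⟧-∁
    ; γ-⊤              = ⟦⟧-⊤
    ; γ-⊥              = ⟦⟧-⊥
    ; γ-′              = ⟦⟧-derivP
    ; γ-injective      = λ _ _ → ⟦⟧-injective
    ; γ-surjective     = ⟦⟧-surjective
    ; lower⇔closed     = lower⇔closed
    ; generation       = λ _ Qs _ → generation-transport ′-cong ⟦⟧-isTBAIsomorphism Qs
    }

lemma3 : ∀ {c ℓ} (D : TBA c ℓ) → Finite D → GeneratedByClosed D →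
    ∃ λ m → ∃ λ (R : Fin m → Fin m → Bool) → IsPO R ×
      ∃ λ (X : Fin m → TBA.Carrier D) → Lemma3Conclusion D R X
lemma3 D finite generated = m , R , (R-antisymmetric generated , R-transitive) , X , conclusion
  where
  open FiniteTBA D finite using (m; X)
  open AtomicRepresentation D finite using (R; R-antisymmetric; R-transitive; conclusion)
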